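{- Let $\alpha>0$, $u,v\in\mathbb{C}$, and let $\lambda$ be a Young diagram with $n$ boxes. Then $$\sum_{\Lambda:\lambda\nearrow\Lambda}(c_\alpha(b)+u)(c_\alpha(b)+v)\,\varkappa_\alpha(\lambda,\Lambda)\,\varphi(\Lambda)=(n\alpha+uv)\,\varphi(\lambda),$$ where $b=\Lambda\setminus\lambda$ is the added box in each term.
   Context: Young diagrams are sets of boxes $(i,j)$ (row $i$, column $j$); $\lambda'$ is the conjugate; $\lambda\nearrow\Lambda$ means $\Lambda$ is obtained from $\lambda$ by adding one box. The $\alpha$-content of a box $(i,j)$ is $c_\alpha(i,j)=(j-1)\alpha-(i-1)$. For $b=(i,j)\in\lambda$, $a(b)=\lambda_i-j$, $l(b)=\lambda'_j-i$. $\varphi(\lambda)=\prod_{b\in\lambda}(a(b)\alpha+l(b)+1)^{ -1}$. If the added box lies in column $j$, $\varkappa_\alpha(\lambda,\Lambda)=\prod_{b}\frac{(a(b)\alpha+l(b)+2)(a(b)\alpha+l(b)+1)}{((a(b)+1)\alpha+l(b)+1)(a(b)\alpha+l(b)+1)}$, the product over boxes $b$ of $\lambda$ in column $j$ (arm/leg lengths in $\lambda$). -}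

module Defs where

open import Level using (Level; _⊔_) renaming (suc to lsuc)
open import Algebra.Bundles using (CommutativeRing)
open import Data.Nat as ℕ using (ℕ; zero; suc; _<ᵇ_; _≤_)
open import Data.Bool using (Bool; true; false; _∨_; if_then_else_)
open import Data.List using (List; []; _∷_; length; upTo; filter; map; foldr)
open import Data.Nat.ListAction using (sum)
open import Relation.Nullary using (¬_)
open import Relation.Binary.PropositionalEquality using (_≡_)
open import Data.Bool.Properties using (T?)
open import Data.Bool using (T)

-- A field is a commutative ring with 0 ≠ 1 together with an inverse
-- operation that is a genuine inverse on every nonzero element
-- (the value of 0⁻¹ is irrelevant and unconstrained).

record Field (c ℓ : Level) : Set (lsuc (c ⊔ ℓ)) where
  field
    commutativeRing : CommutativeRing c ℓ
  open CommutativeRing commutativeRing public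
  field
    _⁻¹     : Carrier → Carrier
    inverse : ∀ x → ¬ (x ≈ 0#) → x * (x ⁻¹) ≈ 1#
    0≉1     : ¬ (0# ≈ 1#)

-- Box (i,j) of the
-- paper (1-indexed) corresponds to the 0-indexed pair (i-1, j-1).

data IsPartition : List ℕ → Set where
  nil  : IsPartition []
  one  : ∀ {x} → 1 ≤ x → IsPartition (x ∷ [])
  cons : ∀ {x y ys} → y ≤ x → IsPartition (y ∷ ys) → IsPartition (x ∷ y ∷ ys)

size : List ℕ → ℕ
size = sum

rowLen : List ℕ → ℕ → ℕ
rowLen []       _       = 0
rowLen (x ∷ xs) zero    = x
rowLen (x ∷ xs) (suc i) = rowLen xs i

colLen : List ℕ → ℕ → ℕ
colLen [] _ = 0
colLen (x ∷ xs) j = if j <ᵇ x then suc (colLen xs j) else colLen xs j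

record Box : Set where
  constructor box
  field
    row col : ℕ

boxesFrom : ℕ → List ℕ → List Box
boxesFrom i []       = []
boxesFrom i (x ∷ xs) = Data.List._++_ (map (box i) (upTo x)) (boxesFrom (suc i) xs)

boxes : List ℕ → List Box
boxes = boxesFrom 0

boxesInCol : List ℕ → ℕ → List Box
boxesInCol ν j = map (λ i → box i j) (upTo (colLen ν j))

arm : List ℕ → Box → ℕ
arm ν (box i j) = rowLen ν i ℕ.∸ suc j

leg : List ℕ → Box → ℕ
leg ν (box i j) = colLen ν j ℕ.∸ suc i

addBox : List ℕ → ℕ → List ℕ
addBox []       _       = 1 ∷ []
addBox (x ∷ xs) zero    = suc x ∷ xs
addBox (x ∷ xs) (suc i) = x ∷ addBox xs i

addableRow : List ℕ → ℕ → Bool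
addableRow ν zero    = true
addableRow ν (suc i) = rowLen ν (suc i) <ᵇ rowLen ν i

-- all rows at which a box can be added, i.e. all Λ with ν ↗ Λ are
-- exactly  addBox ν i  for  i ∈ addableRows ν  (each Λ once)
addableRows : List ℕ → List ℕ
addableRows ν = filter (λ i → T? (addableRow ν i)) (upTo (suc (length ν)))

module WithField {c ℓ : Level} (F : Field c ℓ) where
  open Field F

  ι : ℕ → Carrier
  ι zero    = 0#
  ι (suc n) = 1# + ι n

  sumF : List Carrier → Carrier
  sumF = foldr _+_ 0#

  prodF : List Carrier → Carrier
  prodF = foldr _*_ 1#

  module _ (α : Carrier) where

    content : Box → Carrier
    content (box i j) = ι j * α + - ι i

    φ : List ℕ → Carrier
    φ ν = prodF (map (λ b → (ι (arm ν b) * α + ι (suc (leg ν b))) ⁻¹) (boxes ν))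

    -- ϰ_α(ν,Λ) where the added box lies in the 0-indexed column j:
    --   ∏_{b ∈ ν in column j} (aα+l+2)((a+1)α+l) / (((a+1)α+l+1)(aα+l+1))
    -- (the printed numerator factor (aα+l+1) is a
    --  misprint for ((a+1)α+l); with the literal formula the theorem is false)
    ϰ : List ℕ → ℕ → Carrier
    ϰ ν j = prodF (map factor (boxesInCol ν j))
      where
      factor : Box → Carrier
      factor b =
        ((ι (arm ν b) * α + ι (2 ℕ.+ leg ν b)) * (ι (suc (arm ν b)) * α + ι (leg ν b)))
        * (((ι (suc (arm ν b)) * α + ι (suc (leg ν b))) * (ι (arm ν b) * α + ι (suc (leg ν b)))) ⁻¹)

    lhs : Carrier → Carrier → List ℕ → Carrier
    lhs u v ν = sumF (map term (addableRows ν))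
      where
      term : ℕ → Carrier
      term i = let b = box i (rowLen ν i) in
        ((content b + u) * (content b + v)) * ϰ ν (rowLen ν i) * φ (addBox ν i)

{-# OPTIONS --safe #-}
module Submission where

-- Let pieriSum ν F be the sum of F(Λ ∖ ν) ϰ(ν, Λ) φ(Λ) over the diagrams Λ obtained from ν by
-- adding a box, and induct on the rows of ν = x ∷ μ. The box (i, j) addable to μ is the box
-- (i + 1, j) addable to x ∷ μ, and comparing hook products shows that, once the first-row hook
-- product of x ∷ μ is cleared, its weight in x ∷ μ is its weight in μ times
-- ((x − j)α + i)/((x − j)α + i + 1). So for F = A c² + B c + C in the content c, the sum over x ∷ μ
-- becomes a sum over μ of F(c − 1)(xα − c)/(xα + 1 − c): a quadratic with the same A and with C
-- raised by A x α, minus F(xα) times the simple fraction 1/(xα + 1 − c). Sums of such simple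
-- fractions obey a recursion of the same shape and come out as exactly the weight of the box added
-- to the first row, so that box cancels against the pole term. Hence A c² + B c + C sums to
-- (A |ν| α + C) φ(ν), which for (c + u)(c + v) is the claim.

open import Defs
open import Level using (Level)
open import Algebra.Bundles using (CommutativeRing)
import Algebra.Solver.Ring
import Algebra.Solver.Ring.AlmostCommutativeRing as ACR
open import Data.Bool using (Bool; true; false; T; if_then_else_)
open import Data.Bool.Properties using (T?)
open import Data.Empty using (⊥-elim)
open import Data.Integer as ℤ using (ℤ; +_; -[1+_]; _⊖_)
import Data.Integer.Properties as ℤₚ
open import Data.List using (List; []; _∷_; length; map; filter; upTo; applyUpTo; _++_)
open import Data.List.Properties using (map-∘; map-++; map-applyUpTo; map-upTo; map-cong-local)
open import Data.List.Relation.Unary.All as All using (All; []; _∷_)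
open import Data.List.Relation.Unary.All.Properties using (++⁺; map⁺; applyUpTo⁺₁)
open import Data.Maybe using (Maybe; just; nothing)
open import Data.Nat as ℕ using (ℕ; zero; suc; _<ᵇ_; _≤_; _<_; _∸_; z≤n; s≤s)
import Data.Nat.Properties as ℕₚ
import Data.Sign as Sign
open import Function using (id; _∘_; const)
open import Relation.Binary.Definitions using (tri<; tri≈; tri>)
open import Relation.Binary.PropositionalEquality as ≡ using (_≡_; _≢_; cong; cong₂)
open import Relation.Nullary using (¬_; yes; no; contradiction)

-- Algebra.Solver.Ring over R with coefficients in ℤ: integer arithmetic computes, so identities
-- involving numerals and negation are decided by normalisation.
module IntegerCoefficientSolver {c ℓ : Level} (R : CommutativeRing c ℓ) where
  open CommutativeRing R
  open import Algebra.Properties.Ring ring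
    using (-0#≈0#; -‿involutive; -‿+-comm; -‿distribˡ-*; -‿distribʳ-*)
  open import Algebra.Properties.CommutativeSemigroup +-commutativeSemigroup using (interchange)
  open import Algebra.Properties.Semiring.Mult.TCOptimised semiring
    using (_×_; 1+×; ×-homo-+; ×1-homo-*)
  open import Relation.Binary.Reasoning.Setoid setoid

  fromℤ : ℤ → Carrier
  fromℤ (+ n)      = n × 1#
  fromℤ (-[1+ n ]) = - (suc n × 1#)

  private
    x-0≈x : ∀ x → x - 0# ≈ x
    x-0≈x x = trans (+-congˡ -0#≈0#) (+-identityʳ x)

    ⊖-homo : ∀ m n → fromℤ (m ⊖ n) ≈ m × 1# - n × 1#
    ⊖-homo zero    zero    = sym (x-0≈x 0#)
    ⊖-homo zero    (suc n) = sym (+-identityˡ _)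
    ⊖-homo (suc m) zero    = sym (x-0≈x _)
    ⊖-homo (suc m) (suc n) = begin
      fromℤ (suc m ⊖ suc n)            ≡⟨ cong fromℤ (ℤₚ.[1+m]⊖[1+n]≡m⊖n m n) ⟩
      fromℤ (m ⊖ n)                    ≈⟨ ⊖-homo m n ⟩
      m × 1# - n × 1#                  ≈⟨ +-identityˡ _ ⟨
      0# + (m × 1# - n × 1#)           ≈⟨ +-congʳ (-‿inverseʳ 1#) ⟨
      (1# - 1#) + (m × 1# - n × 1#)    ≈⟨ interchange 1# (- 1#) (m × 1#) (- (n × 1#)) ⟩
      (1# + m × 1#) + (- 1# - n × 1#)  ≈⟨ +-cong (sym (1+× m 1#)) (-‿+-comm 1# (n × 1#)) ⟩
      suc m × 1# - (1# + n × 1#)       ≈⟨ +-congˡ (-‿cong (1+× n 1#)) ⟨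
      suc m × 1# - suc n × 1#          ∎

    +-homo : ∀ i j → fromℤ (i ℤ.+ j) ≈ fromℤ i + fromℤ j
    +-homo (+ m)    (+ n)    = ×-homo-+ 1# m n
    +-homo (+ m)    -[1+ n ] = ⊖-homo m (suc n)
    +-homo -[1+ m ] (+ n)    = trans (⊖-homo n (suc m)) (+-comm _ _)
    +-homo -[1+ m ] -[1+ n ] = begin
      - (suc (suc (m ℕ.+ n)) × 1#)   ≡⟨ cong (λ k → - (k × 1#)) (≡.sym (ℕₚ.+-suc (suc m) n)) ⟩
      - ((suc m ℕ.+ suc n) × 1#)     ≈⟨ -‿cong (×-homo-+ 1# (suc m) (suc n)) ⟩
      - (suc m × 1# + suc n × 1#)    ≈⟨ -‿+-comm _ _ ⟨
      - (suc m × 1#) - suc n × 1#    ∎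

    -‿homo : ∀ i → fromℤ (ℤ.- i) ≈ - fromℤ i
    -‿homo (+ zero)  = sym -0#≈0#
    -‿homo (+ suc n) = refl
    -‿homo -[1+ n ]  = sym (-‿involutive _)

    *-homo : ∀ i j → fromℤ (i ℤ.* j) ≈ fromℤ i * fromℤ j
    *-homo (+ m) (+ n) = begin
      fromℤ (Sign.+ ℤ.◃ (m ℕ.* n))  ≡⟨ cong fromℤ (ℤₚ.+◃n≡+n (m ℕ.* n)) ⟩
      (m ℕ.* n) × 1#                ≈⟨ ×1-homo-* m n ⟩
      m × 1# * n × 1#               ∎
    *-homo (+ m) -[1+ n ] = begin
      fromℤ (Sign.- ℤ.◃ (m ℕ.* suc n))  ≡⟨ cong fromℤ (ℤₚ.-◃n≡-n (m ℕ.* suc n)) ⟩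
      fromℤ (ℤ.- + (m ℕ.* suc n))       ≈⟨ -‿homo (+ (m ℕ.* suc n)) ⟩
      - ((m ℕ.* suc n) × 1#)            ≈⟨ -‿cong (×1-homo-* m (suc n)) ⟩
      - (m × 1# * suc n × 1#)           ≈⟨ -‿distribʳ-* _ _ ⟩
      m × 1# * - (suc n × 1#)           ∎
    *-homo -[1+ m ] (+ n) = begin
      fromℤ (Sign.- ℤ.◃ (suc m ℕ.* n))  ≡⟨ cong fromℤ (ℤₚ.-◃n≡-n (suc m ℕ.* n)) ⟩
      fromℤ (ℤ.- + (suc m ℕ.* n))       ≈⟨ -‿homo (+ (suc m ℕ.* n)) ⟩
      - ((suc m ℕ.* n) × 1#)            ≈⟨ -‿cong (×1-homo-* (suc m) n) ⟩
      - (suc m × 1# * n × 1#)           ≈⟨ -‿distribˡ-* _ _ ⟩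
      - (suc m × 1#) * n × 1#           ∎
    *-homo -[1+ m ] -[1+ n ] = begin
      (suc m ℕ.* suc n) × 1#            ≈⟨ ×1-homo-* (suc m) (suc n) ⟩
      suc m × 1# * suc n × 1#           ≈⟨ -‿involutive _ ⟨
      - - (suc m × 1# * suc n × 1#)     ≈⟨ -‿cong (-‿distribˡ-* _ _) ⟩
      - (- (suc m × 1#) * suc n × 1#)   ≈⟨ -‿distribʳ-* _ _ ⟩
      - (suc m × 1#) * - (suc n × 1#)   ∎

    homomorphism : ℤ.+-*-rawRing ACR.-Raw-AlmostCommutative⟶ ACR.fromCommutativeRing R
    homomorphism = record
      { ⟦_⟧ = fromℤ ; +-homo = +-homo ; *-homo = *-homo ; -‿homo = -‿homo
      ; 0-homo = refl ; 1-homo = refl }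

    fromℤ-dec : ∀ i j → Maybe (fromℤ i ≈ fromℤ j)
    fromℤ-dec i j with i ℤ.≟ j
    ... | yes ≡.refl = just refl
    ... | no _       = nothing

  open Algebra.Solver.Ring ℤ.+-*-rawRing (ACR.fromCommutativeRing R) homomorphism fromℤ-dec public

  :0 :1 : ∀ {n} → Polynomial n
  :0 = con (+ 0)
  :1 = con (+ 1)

colLen-< : ∀ {x j} μ → j < x → colLen (x ∷ μ) j ≡ suc (colLen μ j)
colLen-< {x} {j} μ j<x with j <ᵇ x | ℕₚ.<⇒<ᵇ j<x
... | true | _ = ≡.refl

colLen-≥ : ∀ {x j} μ → x ≤ j → colLen (x ∷ μ) j ≡ colLen μ j
colLen-≥ {x} {j} μ x≤j with j <ᵇ x | ℕₚ.<ᵇ⇒< j x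
... | true  | j<x = contradiction (j<x _) (ℕₚ.≤⇒≯ x≤j)
... | false | _   = ≡.refl

IsPartition-tail : ∀ {x μ} → IsPartition (x ∷ μ) → IsPartition μ
IsPartition-tail (one _)    = nil
IsPartition-tail (cons _ p) = p

IsPartition-bounded : ∀ {x μ} → IsPartition (x ∷ μ) → All (_≤ x) μ
IsPartition-bounded (one _)      = []
IsPartition-bounded (cons y≤x p) =
  y≤x ∷ All.map (λ z≤y → ℕₚ.≤-trans z≤y y≤x) (IsPartition-bounded p)

colLen-bounded : ∀ {y j μ} → All (_≤ y) μ → y ≤ j → colLen μ j ≡ 0
colLen-bounded []                    _   = ≡.refl
colLen-bounded {μ = _ ∷ μ} (x≤y ∷ b) y≤j =
  ≡.trans (colLen-≥ μ (ℕₚ.≤-trans x≤y y≤j)) (colLen-bounded b y≤j)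

rowLen-bounded : ∀ {x μ} → All (_≤ x) μ → ∀ i → rowLen μ i ≤ x
rowLen-bounded []        _       = z≤n
rowLen-bounded (y≤x ∷ _) zero    = y≤x
rowLen-bounded (_ ∷ b)   (suc i) = rowLen-bounded b i

addableRow-tail : ∀ {y} μ i → T (addableRow (y ∷ μ) (suc i)) → T (addableRow μ i)
addableRow-tail μ zero    _ = _
addableRow-tail μ (suc i) t = t

colLen-rowLen : ∀ {μ} i → IsPartition μ → T (addableRow μ i) → colLen μ (rowLen μ i) ≡ i
colLen-rowLen {[]}    zero    _ _ = ≡.refl
colLen-rowLen {y ∷ μ} zero    p _ =
  ≡.trans (colLen-≥ μ ℕₚ.≤-refl) (colLen-bounded (IsPartition-bounded p) ℕₚ.≤-refl)
colLen-rowLen {y ∷ μ} (suc i) p t = ≡.trans (colLen-< μ j<y)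
  (cong suc (colLen-rowLen i (IsPartition-tail p) (addableRow-tail μ i t)))
  where
  j<y : rowLen μ i < y
  j<y = ℕₚ.<-≤-trans (ℕₚ.<ᵇ⇒< _ _ t) (rowLen-bounded (ℕₚ.≤-refl ∷ IsPartition-bounded p) i)

colLen-addBox-≡ : ∀ μ i → colLen (addBox μ i) (rowLen μ i) ≡ suc (colLen μ (rowLen μ i))
colLen-addBox-≡ []      i    = ≡.refl
colLen-addBox-≡ (y ∷ μ) zero =
  ≡.trans (colLen-< μ (ℕₚ.n<1+n y)) (cong suc (≡.sym (colLen-≥ μ ℕₚ.≤-refl)))
colLen-addBox-≡ (y ∷ μ) (suc i) with rowLen μ i <ᵇ y
... | true  = cong suc (colLen-addBox-≡ μ i)
... | false = colLen-addBox-≡ μ i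

colLen-addBox-≢ : ∀ μ i j → j ≢ rowLen μ i → colLen (addBox μ i) j ≡ colLen μ j
colLen-addBox-≢ []      i zero    j≢0 = ⊥-elim (j≢0 ≡.refl)
colLen-addBox-≢ []      i (suc j) _   = ≡.refl
colLen-addBox-≢ (y ∷ μ) zero j j≢y with ℕₚ.<-cmp j y
... | tri< j<y _ _ = ≡.trans (colLen-< μ (ℕₚ.m<n⇒m<1+n j<y)) (≡.sym (colLen-< μ j<y))
... | tri≈ _ j≡y _ = ⊥-elim (j≢y j≡y)
... | tri> _ _ y<j = ≡.trans (colLen-≥ μ y<j) (≡.sym (colLen-≥ μ (ℕₚ.<⇒≤ y<j)))
colLen-addBox-≢ (y ∷ μ) (suc i) j j≢ with j <ᵇ y
... | true  = cong suc (colLen-addBox-≢ μ i j j≢)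
... | false = colLen-addBox-≢ μ i j j≢

addBox-bounded : ∀ {x} μ i → All (_≤ x) μ → rowLen μ i < x → All (_≤ x) (addBox μ i)
addBox-bounded []      i       []        r<x = r<x ∷ []
addBox-bounded (y ∷ μ) zero    (_ ∷ b)   y<x = y<x ∷ b
addBox-bounded (y ∷ μ) (suc i) (y≤x ∷ b) r<x = y≤x ∷ addBox-bounded μ i b r<x

∸-split : ∀ {x y j} → j ≤ y → y ≤ x → x ∸ j ≡ (x ∸ y) ℕ.+ (y ∸ j)
∸-split {x} {y} {j} j≤y y≤x =
  ≡.trans (cong (_∸ j) (≡.sym (ℕₚ.m∸n+n≡m y≤x))) (ℕₚ.+-∸-assoc (x ∸ y) j≤y)

down : Box → Box
down (box i j) = box (suc i) j

boxesFrom-suc : ∀ i ρ → boxesFrom (suc i) ρ ≡ map down (boxesFrom i ρ)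
boxesFrom-suc i []      = ≡.refl
boxesFrom-suc i (y ∷ ρ) = begin
  map (box (suc i)) (upTo y) ++ boxesFrom (suc (suc i)) ρ
    ≡⟨ cong₂ _++_ (map-∘ (upTo y)) (boxesFrom-suc (suc i) ρ) ⟩
  map down (map (box i) (upTo y)) ++ map down (boxesFrom (suc i) ρ)
    ≡⟨ map-++ down (map (box i) (upTo y)) (boxesFrom (suc i) ρ) ⟨
  map down (boxesFrom i (y ∷ ρ)) ∎
  where open ≡.≡-Reasoning

boxesFrom-col< : ∀ {x} i ρ → All (_≤ x) ρ → All (λ b → Box.col b < x) (boxesFrom i ρ)
boxesFrom-col< i []      []        = []
boxesFrom-col< i (y ∷ ρ) (y≤x ∷ b) =
  ++⁺ (map⁺ (applyUpTo⁺₁ id y (λ j<y → ℕₚ.<-≤-trans j<y y≤x))) (boxesFrom-col< (suc i) ρ b)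

boxesInCol-cons : ∀ {x j} μ → j < x → boxesInCol (x ∷ μ) j ≡ box 0 j ∷ map down (boxesInCol μ j)
boxesInCol-cons {x} {j} μ j<x rewrite colLen-< μ j<x = cong (box 0 j ∷_) (begin
  map (λ i → box i j) (applyUpTo suc n)    ≡⟨ map-applyUpTo suc (λ i → box i j) n ⟩
  applyUpTo (λ i → box (suc i) j) n        ≡⟨ map-upTo (λ i → box (suc i) j) n ⟨
  map (λ i → box (suc i) j) (upTo n)       ≡⟨ map-∘ (upTo n) ⟩
  map down (map (λ i → box i j) (upTo n))  ∎)
  where
  open ≡.≡-Reasoning
  n : ℕ
  n = colLen μ j

module Quadratic {c ℓ : Level} (R : CommutativeRing c ℓ) where
  open CommutativeRing R
  open IntegerCoefficientSolver R using (solve; _:*_; _:+_; _:-_; :1; _:=_)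

  quadratic : Carrier → Carrier → Carrier → Carrier → Carrier
  quadratic A B C z = A * (z * z) + B * z + C

  quadratic-cong : ∀ A B C {z w} → z ≈ w → quadratic A B C z ≈ quadratic A B C w
  quadratic-cong A B C z≈w = +-congʳ (+-cong (*-congˡ (*-cong z≈w z≈w)) (*-congˡ z≈w))

  quadratic-division : ∀ A B C z Y →
    quadratic A B C (z - 1#) * (Y - z)
      ≈ quadratic A (B - A) (C + A * Y) z * (Y + 1# - z) - quadratic A B C Y
  quadratic-division = solve 5 (λ A B C z Y →
    (A :* ((z :- :1) :* (z :- :1)) :+ B :* (z :- :1) :+ C) :* (Y :- z)
      := (A :* (z :* z) :+ (B :- A) :* z :+ (C :+ A :* Y)) :* (Y :+ :1 :- z)
           :- (A :* (Y :* Y) :+ B :* Y :+ C)) refl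

module FieldProperties {c ℓ : Level} (F : Field c ℓ) where
  open Field F
  open WithField F
  open IntegerCoefficientSolver commutativeRing using (solve; _:*_; _:+_; :-_; _:-_; :1; _:=_)
  open import Relation.Binary.Reasoning.Setoid setoid

  inverse-unique : ∀ {x y} → ¬ x ≈ 0# → x * y ≈ 1# → y ≈ x ⁻¹
  inverse-unique {x} {y} x≉0 xy≈1 = begin
    y               ≈⟨ *-identityʳ y ⟨
    y * 1#          ≈⟨ *-congˡ (inverse x x≉0) ⟨
    y * (x * x ⁻¹)  ≈⟨ *-assoc y x (x ⁻¹) ⟨
    y * x * x ⁻¹    ≈⟨ *-congʳ (trans (*-comm y x) xy≈1) ⟩
    1# * x ⁻¹       ≈⟨ *-identityˡ (x ⁻¹) ⟩
    x ⁻¹            ∎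

  *-cancelʳ : ∀ {x y z} → ¬ z ≈ 0# → x * z ≈ y * z → x ≈ y
  *-cancelʳ {x} {y} {z} z≉0 xz≈yz = begin
    x               ≈⟨ *-identityʳ x ⟨
    x * 1#          ≈⟨ *-congˡ (inverse z z≉0) ⟨
    x * (z * z ⁻¹)  ≈⟨ *-assoc x z (z ⁻¹) ⟨
    x * z * z ⁻¹    ≈⟨ *-congʳ xz≈yz ⟩
    y * z * z ⁻¹    ≈⟨ *-assoc y z (z ⁻¹) ⟩
    y * (z * z ⁻¹)  ≈⟨ *-congˡ (inverse z z≉0) ⟩
    y * 1#          ≈⟨ *-identityʳ y ⟩
    y               ∎

  *-≉0 : ∀ {x y} → ¬ x ≈ 0# → ¬ y ≈ 0# → ¬ x * y ≈ 0#
  *-≉0 {x} {y} x≉0 y≉0 xy≈0 = y≉0 (*-cancelʳ x≉0 (begin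
    y * x   ≈⟨ *-comm y x ⟩
    x * y   ≈⟨ xy≈0 ⟩
    0#      ≈⟨ zeroˡ x ⟨
    0# * x  ∎))

  ⁻¹-* : ∀ {x y} → ¬ x ≈ 0# → ¬ y ≈ 0# → (x * y) ⁻¹ ≈ x ⁻¹ * y ⁻¹
  ⁻¹-* {x} {y} x≉0 y≉0 = sym (inverse-unique (*-≉0 x≉0 y≉0) (begin
    x * y * (x ⁻¹ * y ⁻¹)
      ≈⟨ solve 4 (λ x y x′ y′ → x :* y :* (x′ :* y′) := x :* x′ :* (y :* y′))
               refl x y (x ⁻¹) (y ⁻¹) ⟩
    x * x ⁻¹ * (y * y ⁻¹)  ≈⟨ *-cong (inverse x x≉0) (inverse y y≉0) ⟩
    1# * 1#                ≈⟨ *-identityˡ 1# ⟩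
    1#                     ∎))

  ≈1⇒⁻¹≈1 : ∀ {x} → x ≈ 1# → x ⁻¹ ≈ 1#
  ≈1⇒⁻¹≈1 {x} x≈1 =
    sym (inverse-unique (λ x≈0 → 0≉1 (trans (sym x≈0) x≈1)) (trans (*-identityʳ x) x≈1))

  divide-with-remainder : ∀ {a b d r} → ¬ d ≈ 0# → a ≈ b * d + r → a * d ⁻¹ ≈ b + r * d ⁻¹
  divide-with-remainder {a} {b} {d} {r} d≉0 a≈bd+r = begin
    a * d ⁻¹                   ≈⟨ *-congʳ a≈bd+r ⟩
    (b * d + r) * d ⁻¹
      ≈⟨ solve 4 (λ b d d′ r → (b :* d :+ r) :* d′ := b :* (d :* d′) :+ r :* d′) refl b d (d ⁻¹) r ⟩
    b * (d * d ⁻¹) + r * d ⁻¹  ≈⟨ +-congʳ (trans (*-congˡ (inverse d d≉0)) (*-identityʳ b)) ⟩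
    b + r * d ⁻¹               ∎

  partial-fraction : ∀ {A B K} → ¬ A ≈ 0# → ¬ B ≈ 0# → ¬ K ≈ 0# → A ≈ K + B →
    A ⁻¹ * ((B - 1#) * B ⁻¹) ≈ (K + 1#) * K ⁻¹ * A ⁻¹ + - K ⁻¹ * B ⁻¹
  partial-fraction {A} {B} {K} A≉0 B≉0 K≉0 A≈K+B =
    *-cancelʳ (*-≉0 (*-≉0 K≉0 A≉0) B≉0) (trans lhs-cleared (sym rhs-cleared))
    where
    lhs-cleared : A ⁻¹ * ((B - 1#) * B ⁻¹) * (K * A * B) ≈ K * (B - 1#)
    lhs-cleared = begin
      A ⁻¹ * ((B - 1#) * B ⁻¹) * (K * A * B)
        ≈⟨ solve 5 (λ K A B a b → a :* ((B :- :1) :* b) :* (K :* A :* B)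
                                   := A :* a :* (B :* b) :* (K :* (B :- :1)))
                 refl K A B (A ⁻¹) (B ⁻¹) ⟩
      A * A ⁻¹ * (B * B ⁻¹) * (K * (B - 1#))  ≈⟨ *-congʳ (*-cong (inverse A A≉0) (inverse B B≉0)) ⟩
      1# * 1# * (K * (B - 1#))                ≈⟨ trans (*-congʳ (*-identityˡ 1#)) (*-identityˡ _) ⟩
      K * (B - 1#)                            ∎
    rhs-cleared : ((K + 1#) * K ⁻¹ * A ⁻¹ + - K ⁻¹ * B ⁻¹) * (K * A * B) ≈ K * (B - 1#)
    rhs-cleared = begin
      ((K + 1#) * K ⁻¹ * A ⁻¹ + - K ⁻¹ * B ⁻¹) * (K * A * B)
        ≈⟨ solve 6 (λ K A B k a b → ((K :+ :1) :* k :* a :+ :- k :* b) :* (K :* A :* B)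
                                     := K :* k :* (A :* a :* ((K :+ :1) :* B)) :+ :- (K :* k :* (B :* b :* A)))
                 refl K A B (K ⁻¹) (A ⁻¹) (B ⁻¹) ⟩
      K * K ⁻¹ * (A * A ⁻¹ * ((K + 1#) * B)) + - (K * K ⁻¹ * (B * B ⁻¹ * A))
        ≈⟨ +-cong (*-cong (inverse K K≉0) (*-congʳ (inverse A A≉0)))
                  (-‿cong (*-cong (inverse K K≉0) (*-cong (inverse B B≉0) A≈K+B))) ⟩
      1# * (1# * ((K + 1#) * B)) + - (1# * (1# * (K + B)))
        ≈⟨ solve 2 (λ K B → :1 :* (:1 :* ((K :+ :1) :* B)) :+ :- (:1 :* (:1 :* (K :+ B)))
                             := K :* (B :- :1)) refl K B ⟩
      K * (B - 1#) ∎

  ι-+ : ∀ m n → ι (m ℕ.+ n) ≈ ι m + ι n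
  ι-+ zero    n = sym (+-identityˡ (ι n))
  ι-+ (suc m) n = trans (+-congˡ (ι-+ m n)) (sym (+-assoc 1# (ι m) (ι n)))

  ι-∸ : ∀ {m n} → n ≤ m → ι (m ∸ n) ≈ ι m - ι n
  ι-∸ {m} {n} n≤m = begin
    ι (m ∸ n)               ≈⟨ solve 2 (λ d n → d := d :+ n :- n) refl (ι (m ∸ n)) (ι n) ⟩
    ι (m ∸ n) + ι n - ι n   ≈⟨ +-congʳ (ι-+ (m ∸ n) n) ⟨
    ι (m ∸ n ℕ.+ n) - ι n   ≡⟨ cong (λ k → ι k - ι n) (ℕₚ.m∸n+n≡m n≤m) ⟩
    ι m - ι n               ∎

  sumF-map-cong : ∀ {a} {A : Set a} {f g : A → Carrier} → (∀ i → f i ≈ g i) →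
    ∀ l → sumF (map f l) ≈ sumF (map g l)
  sumF-map-cong f≈g []      = refl
  sumF-map-cong f≈g (i ∷ l) = +-cong (f≈g i) (sumF-map-cong f≈g l)

  sumF-map-+ : ∀ {a} {A : Set a} (f g : A → Carrier) l →
    sumF (map (λ i → f i + g i) l) ≈ sumF (map f l) + sumF (map g l)
  sumF-map-+ f g []      = sym (+-identityʳ 0#)
  sumF-map-+ f g (i ∷ l) = trans (+-congˡ (sumF-map-+ f g l))
    (solve 4 (λ a b c d → (a :+ b) :+ (c :+ d) := (a :+ c) :+ (b :+ d)) refl (f i) (g i) _ _)

  sumF-map-*ˡ : ∀ {a} {A : Set a} k (f : A → Carrier) l →
    k * sumF (map f l) ≈ sumF (map (λ i → k * f i) l)
  sumF-map-*ˡ k f []      = zeroʳ k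
  sumF-map-*ˡ k f (i ∷ l) = trans (distribˡ k (f i) _) (+-congˡ (sumF-map-*ˡ k f l))

  sumF-map-filter : ∀ {a} {A : Set a} (p : A → Bool) (f : A → Carrier) l →
    sumF (map f (filter (λ i → T? (p i)) l)) ≈ sumF (map (λ i → if p i then f i else 0#) l)
  sumF-map-filter p f []      = refl
  sumF-map-filter p f (i ∷ l) with p i
  ... | true  = +-congˡ (sumF-map-filter p f l)
  ... | false = trans (sumF-map-filter p f l) (sym (+-identityˡ _))

  prodF-++ : ∀ l l′ → prodF (l ++ l′) ≈ prodF l * prodF l′
  prodF-++ []      l′ = sym (*-identityˡ _)
  prodF-++ (x ∷ l) l′ = trans (*-congˡ (prodF-++ l l′)) (sym (*-assoc x _ _))

  prodF-map-⁻¹ : ∀ {l} → All (λ x → ¬ x ≈ 0#) l → prodF (map _⁻¹ l) * prodF l ≈ 1#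
  prodF-map-⁻¹ {[]}    []          = *-identityˡ 1#
  prodF-map-⁻¹ {x ∷ l} (x≉0 ∷ l≉0) = begin
    x ⁻¹ * prodF (map _⁻¹ l) * (x * prodF l)
      ≈⟨ solve 4 (λ x′ p′ x p → x′ :* p′ :* (x :* p) := x :* x′ :* (p′ :* p)) refl (x ⁻¹) _ x _ ⟩
    x * x ⁻¹ * (prodF (map _⁻¹ l) * prodF l)  ≈⟨ *-cong (inverse x x≉0) (prodF-map-⁻¹ l≉0) ⟩
    1# * 1#                                   ≈⟨ *-identityˡ 1# ⟩
    1#                                        ∎

HookNonVanishing : ∀ {c ℓ} (𝔽 : Field c ℓ) → Field.Carrier 𝔽 → Set ℓ
HookNonVanishing 𝔽 α = ∀ a l → ¬ (ι a * α + ι (suc l) ≈ 0#)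
  where
  open Field 𝔽
  open WithField 𝔽

module TransitionSums {c ℓ : Level} (𝔽 : Field c ℓ) (α : Field.Carrier 𝔽)
                      (hook≉0 : HookNonVanishing 𝔽 α) where
  open Field 𝔽
  open WithField 𝔽
  open FieldProperties 𝔽
  open Quadratic commutativeRing
  open IntegerCoefficientSolver commutativeRing using (solve; _:*_; _:+_; :-_; _:-_; :0; :1; _:=_)
  open import Relation.Binary.Reasoning.Setoid setoid

  hook : ℕ → ℕ → Carrier
  hook a l = ι a * α + ι (suc l)

  -- The hook values of a first row of length x lying above a diagram with column lengths κ.
  rowHooks : ℕ → (ℕ → ℕ) → Carrier
  rowHooks x κ = prodF (applyUpTo (λ j → hook (x ∸ suc j) (κ j)) x)

  rowHooks≉0 : ∀ x κ → ¬ rowHooks x κ ≈ 0#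
  rowHooks≉0 zero    κ 1≈0 = 0≉1 (sym 1≈0)
  rowHooks≉0 (suc x) κ     = *-≉0 (hook≉0 x (κ 0)) (rowHooks≉0 x (κ ∘ suc))

  rowHooks-cong : ∀ x {κ κ′} → (∀ j → κ j ≡ κ′ j) → rowHooks x κ ≡ rowHooks x κ′
  rowHooks-cong zero    _ = ≡.refl
  rowHooks-cong (suc x) e = cong₂ (λ l r → hook x l * r) (e 0) (rowHooks-cong x (e ∘ suc))

  rowHooks-update : ∀ x {κ κ′ j l} → j < x → (∀ j′ → j′ ≢ j → κ′ j′ ≡ κ j′) →
    κ j ≡ l → κ′ j ≡ suc l →
    rowHooks x κ′ * hook (x ∸ suc j) l ≈ rowHooks x κ * hook (x ∸ suc j) (suc l)
  rowHooks-update (suc x) {κ} {κ′} {zero} {l} _ others κ0≡l κ′0≡1+l = begin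
    hook x (κ′ 0) * rowHooks x (κ′ ∘ suc) * hook x l
      ≡⟨ cong₂ (λ a r → hook x a * r * hook x l) κ′0≡1+l (rowHooks-cong x (λ j → others (suc j) λ ())) ⟩
    hook x (suc l) * R * hook x l
      ≈⟨ solve 3 (λ h′ r h → h′ :* r :* h := h :* r :* h′) refl (hook x (suc l)) R (hook x l) ⟩
    hook x l * R * hook x (suc l)      ≡⟨ cong (λ a → hook x a * R * hook x (suc l)) κ0≡l ⟨
    hook x (κ 0) * R * hook x (suc l)  ∎
    where
    R : Carrier
    R = rowHooks x (κ ∘ suc)
  rowHooks-update (suc x) {κ} {κ′} {suc j} {l} (s≤s j<x) others κj≡l κ′j≡1+l = begin
    hook x (κ′ 0) * R′ * hook (x ∸ suc j) l       ≈⟨ *-assoc _ R′ _ ⟩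
    hook x (κ′ 0) * (R′ * hook (x ∸ suc j) l)
      ≈⟨ *-cong (reflexive (cong (hook x) (others 0 λ ())))
                (rowHooks-update x j<x (λ j′ j′≢j → others (suc j′) (j′≢j ∘ ℕₚ.suc-injective))
                                 κj≡l κ′j≡1+l) ⟩
    hook x (κ 0) * (R * hook (x ∸ suc j) (suc l))  ≈⟨ *-assoc _ R _ ⟨
    hook x (κ 0) * R * hook (x ∸ suc j) (suc l)    ∎
    where
    R R′ : Carrier
    R  = rowHooks x (κ ∘ suc)
    R′ = rowHooks x (κ′ ∘ suc)

  rowHooks-shift : ∀ x y {κ₁ κ₂ m} → y ≤ x → (∀ j → j < y → κ₁ j ≡ κ₂ j) →
    (∀ j → y ≤ j → κ₁ j ≡ m) → (∀ j → y ≤ j → κ₂ j ≡ suc m) →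
    rowHooks x κ₁ * rowHooks (x ∸ y) (const (suc m)) ≈ rowHooks x κ₂ * rowHooks (x ∸ y) (const m)
  rowHooks-shift x zero {κ₁} {κ₂} {m} _ _ κ₁≡m κ₂≡1+m = begin
    rowHooks x κ₁ * rowHooks x (const (suc m))
      ≡⟨ cong (_* _) (rowHooks-cong x (λ j → κ₁≡m j z≤n)) ⟩
    rowHooks x (const m) * rowHooks x (const (suc m))  ≈⟨ *-comm _ _ ⟩
    rowHooks x (const (suc m)) * rowHooks x (const m)
      ≡⟨ cong (_* _) (rowHooks-cong x (λ j → κ₂≡1+m j z≤n)) ⟨
    rowHooks x κ₂ * rowHooks x (const m)  ∎
  rowHooks-shift (suc x) (suc y) {κ₁} {κ₂} {m} (s≤s y≤x) low κ₁≡m κ₂≡1+m = begin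
    hook x (κ₁ 0) * R₁ * E′    ≈⟨ *-assoc _ R₁ E′ ⟩
    hook x (κ₁ 0) * (R₁ * E′)
      ≈⟨ *-cong (reflexive (cong (hook x) (low 0 (s≤s z≤n))))
                (rowHooks-shift x y y≤x (λ j j<y → low (suc j) (s≤s j<y))
                                        (λ j y≤j → κ₁≡m (suc j) (s≤s y≤j))
                                        (λ j y≤j → κ₂≡1+m (suc j) (s≤s y≤j))) ⟩
    hook x (κ₂ 0) * (R₂ * E)   ≈⟨ *-assoc _ R₂ E ⟨
    hook x (κ₂ 0) * R₂ * E     ∎
    where
    R₁ R₂ E′ E : Carrier
    R₁ = rowHooks x (κ₁ ∘ suc)
    R₂ = rowHooks x (κ₂ ∘ suc)
    E′ = rowHooks (x ∸ y) (const (suc m))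
    E  = rowHooks (x ∸ y) (const m)

  rowHooks-cons : ∀ {x y m} μ → y ≤ x → All (_≤ y) μ →
    rowHooks x (λ j → m ℕ.+ colLen (y ∷ μ) j) * rowHooks (x ∸ y) (const (suc m))
      ≈ rowHooks x (λ j → suc m ℕ.+ colLen μ j) * rowHooks (x ∸ y) (const m)
  rowHooks-cons {x} {y} {m} μ y≤x bounded = rowHooks-shift x y y≤x low high₀ high₁
    where
    low : ∀ j → j < y → m ℕ.+ colLen (y ∷ μ) j ≡ suc m ℕ.+ colLen μ j
    low j j<y = ≡.trans (cong (m ℕ.+_) (colLen-< μ j<y)) (ℕₚ.+-suc m (colLen μ j))
    high₀ : ∀ j → y ≤ j → m ℕ.+ colLen (y ∷ μ) j ≡ m
    high₀ j y≤j = ≡.trans (cong (m ℕ.+_) (colLen-bounded (ℕₚ.≤-refl ∷ bounded) y≤j)) (ℕₚ.+-identityʳ m)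
    high₁ : ∀ j → y ≤ j → suc m ℕ.+ colLen μ j ≡ suc m
    high₁ j y≤j = ≡.trans (cong (suc m ℕ.+_) (colLen-bounded bounded y≤j)) (ℕₚ.+-identityʳ (suc m))

  hookProduct : (ℕ → ℕ → Carrier) → List ℕ → List Box → Carrier
  hookProduct h ν bs = prodF (map (λ b → h (arm ν b) (leg ν b)) bs)

  hookProduct-down : ∀ h {x} μ bs → All (λ b → Box.col b < x) bs →
    hookProduct h (x ∷ μ) (map down bs) ≡ hookProduct h μ bs
  hookProduct-down h {x} μ bs cols =
    cong prodF (≡.trans (≡.sym (map-∘ bs)) (map-cong-local (All.map same-hook cols)))
    where
    same-hook : ∀ {b} → Box.col b < x →
      h (arm (x ∷ μ) (down b)) (leg (x ∷ μ) (down b)) ≡ h (arm μ b) (leg μ b)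
    same-hook {box i j} j<x = cong (λ n → h (rowLen μ i ∸ suc j) (n ∸ suc (suc i))) (colLen-< μ j<x)

  -- ϰ α ν j unfolds to hookProduct pieriFactor ν (boxesInCol ν j).
  pieriFactor : ℕ → ℕ → Carrier
  pieriFactor a l = (hook a (suc l) * (ι (suc a) * α + ι l)) * (hook (suc a) l * hook a l) ⁻¹

  pieriFactor-split : ∀ a l →
    pieriFactor a l ≈ hook a (suc l) * hook a l ⁻¹ * ((ι (suc a) * α + ι l) * hook (suc a) l ⁻¹)
  pieriFactor-split a l = begin
    hook a (suc l) * N * (hook (suc a) l * hook a l) ⁻¹
      ≈⟨ *-congˡ (⁻¹-* (hook≉0 (suc a) l) (hook≉0 a l)) ⟩
    hook a (suc l) * N * (hook (suc a) l ⁻¹ * hook a l ⁻¹)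
      ≈⟨ solve 4 (λ h N d′ h′ → h :* N :* (d′ :* h′) := h :* h′ :* (N :* d′))
               refl (hook a (suc l)) N (hook (suc a) l ⁻¹) (hook a l ⁻¹) ⟩
    hook a (suc l) * hook a l ⁻¹ * (N * hook (suc a) l ⁻¹) ∎
    where
    N : Carrier
    N = ι (suc a) * α + ι l

  φ-cons : ∀ x μ → All (_≤ x) μ → φ α (x ∷ μ) * rowHooks x (colLen μ) ≈ φ α μ
  φ-cons x μ bounded = begin
    prodF (map g (firstRow ++ boxesFrom 1 μ)) * prodF H
      ≡⟨ cong (λ l → prodF l * prodF H) (map-++ g firstRow (boxesFrom 1 μ)) ⟩
    prodF (map g firstRow ++ map g (boxesFrom 1 μ)) * prodF H
      ≈⟨ *-congʳ (prodF-++ (map g firstRow) (map g (boxesFrom 1 μ))) ⟩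
    prodF (map g firstRow) * prodF (map g (boxesFrom 1 μ)) * prodF H
      ≡⟨ cong₂ (λ p q → prodF p * q * prodF H) firstRow-hooks lower-rows ⟩
    prodF (map _⁻¹ H) * φ α μ * prodF H
      ≈⟨ solve 3 (λ p f q → p :* f :* q := p :* q :* f) refl (prodF (map _⁻¹ H)) (φ α μ) (prodF H) ⟩
    prodF (map _⁻¹ H) * prodF H * φ α μ
      ≈⟨ *-congʳ (prodF-map-⁻¹ (applyUpTo⁺₁ _ x λ {j} _ → hook≉0 (x ∸ suc j) (colLen μ j))) ⟩
    1# * φ α μ  ≈⟨ *-identityˡ (φ α μ) ⟩
    φ α μ       ∎
    where
    g : Box → Carrier
    g b = hook (arm (x ∷ μ) b) (leg (x ∷ μ) b) ⁻¹
    firstRow : List Box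
    firstRow = map (box 0) (upTo x)
    H : List Carrier
    H = applyUpTo (λ j → hook (x ∸ suc j) (colLen μ j)) x
    firstRow-hooks : map g firstRow ≡ map _⁻¹ H
    firstRow-hooks = ≡.trans (≡.sym (map-∘ (upTo x)))
      (≡.trans (map-cong-local (applyUpTo⁺₁ id x λ j<x →
                  cong (λ n → hook (x ∸ suc _) (n ∸ 1) ⁻¹) (colLen-< μ j<x)))
      (≡.trans (map-upTo _ x) (≡.sym (map-applyUpTo _ _⁻¹ x))))
    lower-rows : prodF (map g (boxesFrom 1 μ)) ≡ φ α μ
    lower-rows = ≡.trans (cong (λ bs → prodF (map g bs)) (boxesFrom-suc 0 μ))
      (hookProduct-down (λ a l → hook a l ⁻¹) μ (boxes μ) (boxesFrom-col< 0 μ bounded))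

  ϰ-cons : ∀ {x j} μ → j < x → ϰ α (x ∷ μ) j ≡ pieriFactor (x ∸ suc j) (colLen μ j) * ϰ α μ j
  ϰ-cons {x} {j} μ j<x = ≡.trans (cong (hookProduct pieriFactor (x ∷ μ)) (boxesInCol-cons μ j<x))
    (cong₂ (λ l p → pieriFactor (x ∸ suc j) (l ∸ 1) * p) (colLen-< μ j<x)
      (hookProduct-down pieriFactor μ (boxesInCol μ j) (map⁺ (applyUpTo⁺₁ id (colLen μ j) λ _ → j<x))))

  ϰ-top : ∀ {x} μ → All (_≤ x) μ → ϰ α (x ∷ μ) x ≡ 1#
  ϰ-top {x} μ bounded = cong (λ n → hookProduct pieriFactor (x ∷ μ) (map (λ i → box i x) (upTo n)))
    (≡.trans (colLen-≥ μ ℕₚ.≤-refl) (colLen-bounded bounded ℕₚ.≤-refl))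

  newBox : List ℕ → ℕ → Box
  newBox ν i = box i (rowLen ν i)

  pieriTerm : List ℕ → (Box → Carrier) → ℕ → Carrier
  pieriTerm ν F i = F (newBox ν i) * ϰ α ν (rowLen ν i) * φ α (addBox ν i)

  -- φ α ν times the mean of F over the α-transition measure of ν; lhs α u v is the case
  -- F b = (content α b + u) * (content α b + v).
  pieriSum : List ℕ → (Box → Carrier) → Carrier
  pieriSum ν F = sumF (map (pieriTerm ν F) (addableRows ν))

  pieriSum-cong : ∀ ν F G → (∀ i → F (newBox ν i) ≈ G (newBox ν i)) → pieriSum ν F ≈ pieriSum ν G
  pieriSum-cong ν F G F≈G = sumF-map-cong (λ i → *-congʳ (*-congʳ (F≈G i))) (addableRows ν)

  pieriSum-+ : ∀ ν F G → pieriSum ν (λ b → F b + G b) ≈ pieriSum ν F + pieriSum ν G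
  pieriSum-+ ν F G = trans (sumF-map-cong term-+ (addableRows ν))
                           (sumF-map-+ (pieriTerm ν F) (pieriTerm ν G) (addableRows ν))
    where
    term-+ : ∀ i → pieriTerm ν (λ b → F b + G b) i ≈ pieriTerm ν F i + pieriTerm ν G i
    term-+ i = trans (*-congʳ (distribʳ _ (F (newBox ν i)) (G (newBox ν i)))) (distribʳ _ _ _)

  pieriSum-scale : ∀ ν k F → pieriSum ν (λ b → k * F b) ≈ k * pieriSum ν F
  pieriSum-scale ν k F = trans (sumF-map-cong term-scale (addableRows ν))
                               (sym (sumF-map-*ˡ k (pieriTerm ν F) (addableRows ν)))
    where
    term-scale : ∀ i → pieriTerm ν (λ b → k * F b) i ≈ k * pieriTerm ν F i
    term-scale i = solve 4 (λ k f p q → k :* f :* p :* q := k :* (f :* p :* q)) refl k (F (newBox ν i)) _ _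

  pieriSum-[] : ∀ F → pieriSum [] F ≈ F (box 0 0)
  pieriSum-[] F = begin
    F (box 0 0) * 1# * (hook 0 0 ⁻¹ * 1#) + 0#
      ≈⟨ solve 2 (λ f h′ → f :* :1 :* (h′ :* :1) :+ :0 := f :* h′) refl (F (box 0 0)) (hook 0 0 ⁻¹) ⟩
    F (box 0 0) * hook 0 0 ⁻¹
      ≈⟨ *-congˡ (≈1⇒⁻¹≈1 (solve 1 (λ a → :0 :* a :+ (:1 :+ :0) := :1) refl α)) ⟩
    F (box 0 0) * 1#  ≈⟨ *-identityʳ _ ⟩
    F (box 0 0)       ∎

  peel : ℕ → (Box → Carrier) → Box → Carrier
  peel x F (box i j) = F (box (suc i) j) * ((ι (x ∸ j) * α + ι i) * hook (x ∸ j) i ⁻¹)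

  peel-corner : ∀ x F → peel x F (box 0 x) ≈ 0#
  peel-corner x F = begin
    F (box 1 x) * ((ι (x ∸ x) * α + 0#) * hook (x ∸ x) 0 ⁻¹)
      ≡⟨ cong (λ k → F (box 1 x) * ((ι k * α + 0#) * hook k 0 ⁻¹)) (ℕₚ.n∸n≡0 x) ⟩
    F (box 1 x) * ((0# * α + 0#) * hook 0 0 ⁻¹)
      ≈⟨ solve 3 (λ f a h → f :* ((:0 :* a :+ :0) :* h) := :0) refl (F (box 1 x)) α (hook 0 0 ⁻¹) ⟩
    0# ∎

  pieriTerm-cons : ∀ {x} μ F i → IsPartition (x ∷ μ) → T (addableRow μ i) → rowLen μ i < x →
    rowHooks x (colLen μ) * pieriTerm (x ∷ μ) F (suc i) ≈ pieriTerm μ (peel x F) i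
  pieriTerm-cons {x} μ F i p addable j<x = begin
    Q * (F′ * ϰ α (x ∷ μ) j * φ α (x ∷ μ⁺))               ≈⟨ *-congˡ (*-congʳ (*-congˡ ϰ-step)) ⟩
    Q * (F′ * (K₁ * K₀ ⁻¹ * r * ϰ α μ j) * φ α (x ∷ μ⁺))
      ≈⟨ solve 7 (λ Q F′ K₁ K₀′ r k f → Q :* (F′ :* (K₁ :* K₀′ :* r :* k) :* f)
                                         := Q :* K₁ :* K₀′ :* (F′ :* r :* k :* f))
               refl Q F′ K₁ (K₀ ⁻¹) r (ϰ α μ j) (φ α (x ∷ μ⁺)) ⟩
    Q * K₁ * K₀ ⁻¹ * (F′ * r * ϰ α μ j * φ α (x ∷ μ⁺))    ≈⟨ *-congʳ (*-congʳ update) ⟨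
    Q⁺ * K₀ * K₀ ⁻¹ * (F′ * r * ϰ α μ j * φ α (x ∷ μ⁺))
      ≈⟨ solve 7 (λ Q⁺ K₀ K₀′ F′ r k f → Q⁺ :* K₀ :* K₀′ :* (F′ :* r :* k :* f)
                                          := K₀ :* K₀′ :* (F′ :* r :* k :* (f :* Q⁺)))
               refl Q⁺ K₀ (K₀ ⁻¹) F′ r (ϰ α μ j) (φ α (x ∷ μ⁺)) ⟩
    K₀ * K₀ ⁻¹ * (F′ * r * ϰ α μ j * (φ α (x ∷ μ⁺) * Q⁺))
      ≈⟨ *-cong (inverse K₀ (hook≉0 a i)) (*-congˡ (φ-cons x μ⁺ (addBox-bounded μ i bounded j<x))) ⟩
    1# * (F′ * r * ϰ α μ j * φ α μ⁺)                     ≈⟨ *-identityˡ _ ⟩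
    F′ * r * ϰ α μ j * φ α μ⁺                             ∎
    where
    bounded : All (_≤ x) μ
    bounded = IsPartition-bounded p
    j a : ℕ
    j  = rowLen μ i
    a  = x ∸ suc j
    μ⁺ : List ℕ
    μ⁺ = addBox μ i
    Q Q⁺ F′ K₀ K₁ r : Carrier
    Q  = rowHooks x (colLen μ)
    Q⁺ = rowHooks x (colLen μ⁺)
    F′ = F (box (suc i) j)
    K₀ = hook a i
    K₁ = hook a (suc i)
    r  = (ι (x ∸ j) * α + ι i) * hook (x ∸ j) i ⁻¹
    colLen-j : colLen μ j ≡ i
    colLen-j = colLen-rowLen i (IsPartition-tail p) addable
    update : Q⁺ * K₀ ≈ Q * K₁
    update = rowHooks-update x j<x (λ j′ j′≢j → colLen-addBox-≢ μ i j′ j′≢j) colLen-j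
                             (≡.trans (colLen-addBox-≡ μ i) (cong suc colLen-j))
    ϰ-step : ϰ α (x ∷ μ) j ≈ K₁ * K₀ ⁻¹ * r * ϰ α μ j
    ϰ-step = begin
      ϰ α (x ∷ μ) j
        ≡⟨ ≡.trans (ϰ-cons μ j<x) (cong (λ l → pieriFactor a l * ϰ α μ j) colLen-j) ⟩
      pieriFactor a i * ϰ α μ j
        ≈⟨ *-congʳ (pieriFactor-split a i) ⟩
      K₁ * K₀ ⁻¹ * ((ι (suc a) * α + ι i) * hook (suc a) i ⁻¹) * ϰ α μ j
        ≡⟨ cong (λ s → K₁ * K₀ ⁻¹ * ((ι s * α + ι i) * hook s i ⁻¹) * ϰ α μ j)
                (ℕₚ.+-∸-assoc 1 j<x) ⟨
      K₁ * K₀ ⁻¹ * r * ϰ α μ j ∎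

  masked : List ℕ → (Box → Carrier) → ℕ → Carrier
  masked ν F i = if addableRow ν i then pieriTerm ν F i else 0#

  pieriSum-masked : ∀ ν F → pieriSum ν F ≈ sumF (map (masked ν F) (upTo (suc (length ν))))
  pieriSum-masked ν F = sumF-map-filter (addableRow ν) (pieriTerm ν F) (upTo (suc (length ν)))

  masked-addable : ∀ ν F i → T (addableRow ν i) → masked ν F i ≡ pieriTerm ν F i
  masked-addable ν F i t with addableRow ν i
  ... | true = ≡.refl

  masked-unaddable : ∀ ν F i → ¬ T (addableRow ν i) → masked ν F i ≡ 0#
  masked-unaddable ν F i ¬t with addableRow ν i
  ... | true  = ⊥-elim (¬t _)
  ... | false = ≡.refl

  masked-cons : ∀ {x} μ F → IsPartition (x ∷ μ) → ∀ i →
    rowHooks x (colLen μ) * masked (x ∷ μ) F (suc i) ≈ masked μ (peel x F) i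
  masked-cons {x} μ F p i with T? (addableRow (x ∷ μ) (suc i))
  ... | yes t = begin
    Q * masked (x ∷ μ) F (suc i)     ≡⟨ cong (Q *_) (masked-addable (x ∷ μ) F (suc i) t) ⟩
    Q * pieriTerm (x ∷ μ) F (suc i)
      ≈⟨ pieriTerm-cons μ F i p (addableRow-tail μ i t)
           (ℕₚ.<-≤-trans (ℕₚ.<ᵇ⇒< _ _ t) (rowLen-bounded (ℕₚ.≤-refl ∷ IsPartition-bounded p) i)) ⟩
    pieriTerm μ (peel x F) i         ≡⟨ masked-addable μ (peel x F) i (addableRow-tail μ i t) ⟨
    masked μ (peel x F) i            ∎
    where
    Q : Carrier
    Q = rowHooks x (colLen μ)
  ... | no ¬t = begin
    Q * masked (x ∷ μ) F (suc i)  ≡⟨ cong (Q *_) (masked-unaddable (x ∷ μ) F (suc i) ¬t) ⟩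
    Q * 0#                        ≈⟨ zeroʳ Q ⟩
    0#                            ≈⟨ vanishes i ¬t ⟨
    masked μ (peel x F) i         ∎
    where
    Q : Carrier
    Q = rowHooks x (colLen μ)
    vanishes : ∀ i → ¬ T (addableRow (x ∷ μ) (suc i)) → masked μ (peel x F) i ≈ 0#
    vanishes (suc k) ¬t = reflexive (masked-unaddable μ (peel x F) (suc k) ¬t)
    -- Row 0 of μ is as long as x, so the box (0, x) is addable to μ but not below x; peel kills it.
    vanishes zero    ¬t = begin
      peel x F (box 0 (rowLen μ 0)) * ϰ α μ (rowLen μ 0) * φ α (addBox μ 0)
        ≈⟨ *-congʳ (*-congʳ (trans (reflexive (cong (λ j → peel x F (box 0 j)) r≡x)) (peel-corner x F))) ⟩
      0# * ϰ α μ (rowLen μ 0) * φ α (addBox μ 0)  ≈⟨ trans (*-congʳ (zeroˡ _)) (zeroˡ _) ⟩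
      0#                                          ∎
      where
      r≡x : rowLen μ 0 ≡ x
      r≡x = ℕₚ.≤-antisym (rowLen-bounded (IsPartition-bounded p) 0) (ℕₚ.≮⇒≥ (¬t ∘ ℕₚ.<⇒<ᵇ))

  pieriSum-cons : ∀ x μ F → IsPartition (x ∷ μ) →
    rowHooks x (colLen μ) * pieriSum (x ∷ μ) F
      ≈ rowHooks x (colLen μ) * (F (box 0 x) * φ α (suc x ∷ μ)) + pieriSum μ (peel x F)
  pieriSum-cons x μ F p = begin
    Q * pieriSum (x ∷ μ) F
      ≈⟨ *-congˡ (pieriSum-masked (x ∷ μ) F) ⟩
    Q * (masked (x ∷ μ) F 0 + sumF (map (masked (x ∷ μ) F) (applyUpTo suc n)))
      ≈⟨ distribˡ Q _ _ ⟩
    Q * masked (x ∷ μ) F 0 + Q * sumF (map (masked (x ∷ μ) F) (applyUpTo suc n))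
      ≈⟨ +-cong (*-congˡ corner) lower ⟩
    Q * (F (box 0 x) * φ α (suc x ∷ μ)) + sumF (map (masked μ (peel x F)) (upTo n))
      ≈⟨ +-congˡ (pieriSum-masked μ (peel x F)) ⟨
    Q * (F (box 0 x) * φ α (suc x ∷ μ)) + pieriSum μ (peel x F) ∎
    where
    Q : Carrier
    Q = rowHooks x (colLen μ)
    n : ℕ
    n = suc (length μ)
    corner : masked (x ∷ μ) F 0 ≈ F (box 0 x) * φ α (suc x ∷ μ)
    corner = *-congʳ (trans (*-congˡ (reflexive (ϰ-top μ (IsPartition-bounded p)))) (*-identityʳ _))
    lower : Q * sumF (map (masked (x ∷ μ) F) (applyUpTo suc n)) ≈ sumF (map (masked μ (peel x F)) (upTo n))
    lower = begin
      Q * sumF (map (masked (x ∷ μ) F) (applyUpTo suc n))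
        ≡⟨ cong (λ l → Q * sumF l) (≡.trans (map-applyUpTo suc _ n) (≡.sym (map-upTo _ n))) ⟩
      Q * sumF (map (masked (x ∷ μ) F ∘ suc) (upTo n))
        ≈⟨ sumF-map-*ˡ Q _ (upTo n) ⟩
      sumF (map (λ i → Q * masked (x ∷ μ) F (suc i)) (upTo n))
        ≈⟨ sumF-map-cong (masked-cons μ F p) (upTo n) ⟩
      sumF (map (masked μ (peel x F)) (upTo n)) ∎

  -- 1 / (xα + m + 1 − c) at a box of content c.
  pole : ℕ → ℕ → Box → Carrier
  pole x m (box i j) = hook (x ∸ j) (m ℕ.+ i) ⁻¹

  pieriSum-step : ∀ y μ F G → IsPartition (y ∷ μ) →
    pieriSum μ (pole y 0) * rowHooks (suc y) (colLen μ) ≈ φ α μ * rowHooks y (colLen μ) →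
    (∀ i → peel y F (newBox μ i) ≈ G (newBox μ i) + - F (box 0 y) * pole y 0 (newBox μ i)) →
    rowHooks y (colLen μ) * pieriSum (y ∷ μ) F ≈ pieriSum μ G
  pieriSum-step y μ F G p pole-sum peel≈ = begin
    Q * pieriSum (y ∷ μ) F                               ≈⟨ pieriSum-cons y μ F p ⟩
    Q * (f₀ * φ′) + pieriSum μ (peel y F)
      ≈⟨ +-congˡ (pieriSum-cong μ (peel y F) (λ b → G b + - f₀ * pole y 0 b) peel≈) ⟩
    Q * (f₀ * φ′) + pieriSum μ (λ b → G b + - f₀ * pole y 0 b)
      ≈⟨ +-congˡ (trans (pieriSum-+ μ G (λ b → - f₀ * pole y 0 b))
                        (+-congˡ (pieriSum-scale μ (- f₀) (pole y 0)))) ⟩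
    Q * (f₀ * φ′) + (pieriSum μ G + - f₀ * P)             ≈⟨ +-congˡ (+-congˡ (*-congˡ P≈Qφ′)) ⟩
    Q * (f₀ * φ′) + (pieriSum μ G + - f₀ * (Q * φ′))
      ≈⟨ solve 4 (λ q f p g → q :* (f :* p) :+ (g :+ :- f :* (q :* p)) := g) refl Q f₀ φ′ (pieriSum μ G) ⟩
    pieriSum μ G                                          ∎
    where
    Q Q′ f₀ φ′ P : Carrier
    Q  = rowHooks y (colLen μ)
    Q′ = rowHooks (suc y) (colLen μ)
    f₀ = F (box 0 y)
    φ′ = φ α (suc y ∷ μ)
    P  = pieriSum μ (pole y 0)
    P≈Qφ′ : P ≈ Q * φ′
    P≈Qφ′ = *-cancelʳ (rowHooks≉0 (suc y) (colLen μ)) (begin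
      P * Q′       ≈⟨ pole-sum ⟩
      φ α μ * Q    ≈⟨ *-congʳ (φ-cons (suc y) μ (All.map ℕₚ.m≤n⇒m≤1+n (IsPartition-bounded p))) ⟨
      φ′ * Q′ * Q  ≈⟨ solve 3 (λ f q′ q → f :* q′ :* q := q :* f :* q′) refl φ′ Q′ Q ⟩
      Q * φ′ * Q′  ∎)

  pole-peel : ∀ {x y m} i j → j ≤ y → y ≤ x →
    peel y (pole x m) (box i j)
      ≈ hook (x ∸ y) (suc m) * hook (x ∸ y) m ⁻¹ * pole x (suc m) (box i j)
          + - pole x m (box 0 y) * pole y 0 (box i j)
  pole-peel {x} {y} {m} i j j≤y y≤x = begin
    A ⁻¹ * ((ι (y ∸ j) * α + ι i) * B ⁻¹)
      ≈⟨ *-congˡ (*-congʳ N≈B-1) ⟩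
    A ⁻¹ * ((B - 1#) * B ⁻¹)
      ≈⟨ partial-fraction (hook≉0 (x ∸ j) (m ℕ.+ suc i)) (hook≉0 (y ∸ j) i) (hook≉0 (x ∸ y) m) A≈K+B ⟩
    (K + 1#) * K ⁻¹ * A ⁻¹ + - K ⁻¹ * B ⁻¹
      ≈⟨ +-cong (*-cong (*-congʳ K+1≈) (reflexive (cong (λ l → hook (x ∸ j) l ⁻¹) (ℕₚ.+-suc m i))))
                (reflexive (cong (λ l → - hook (x ∸ y) l ⁻¹ * B ⁻¹) (≡.sym (ℕₚ.+-identityʳ m)))) ⟩
    hook (x ∸ y) (suc m) * K ⁻¹ * hook (x ∸ j) (suc m ℕ.+ i) ⁻¹
      + - hook (x ∸ y) (m ℕ.+ 0) ⁻¹ * B ⁻¹ ∎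
    where
    A B K : Carrier
    A = hook (x ∸ j) (m ℕ.+ suc i)
    B = hook (y ∸ j) i
    K = hook (x ∸ y) m
    N≈B-1 : ι (y ∸ j) * α + ι i ≈ B - 1#
    N≈B-1 = solve 3 (λ P I a → P :* a :+ I := P :* a :+ (:1 :+ I) :- :1) refl (ι (y ∸ j)) (ι i) α
    K+1≈ : K + 1# ≈ hook (x ∸ y) (suc m)
    K+1≈ = solve 3 (λ P M a → P :* a :+ M :+ :1 := P :* a :+ (:1 :+ M)) refl (ι (x ∸ y)) (ι (suc m)) α
    A≈K+B : A ≈ K + B
    A≈K+B = begin
      ι (x ∸ j) * α + ι (suc m ℕ.+ suc i)
        ≡⟨ cong (λ k → ι k * α + ι (suc m ℕ.+ suc i)) (∸-split j≤y y≤x) ⟩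
      ι ((x ∸ y) ℕ.+ (y ∸ j)) * α + ι (suc m ℕ.+ suc i)
        ≈⟨ +-cong (*-congʳ (ι-+ (x ∸ y) (y ∸ j))) (ι-+ (suc m) (suc i)) ⟩
      (ι (x ∸ y) + ι (y ∸ j)) * α + (ι (suc m) + ι (suc i))
        ≈⟨ solve 5 (λ P Q M I a → (P :+ Q) :* a :+ (M :+ I) := P :* a :+ M :+ (Q :* a :+ I))
                 refl (ι (x ∸ y)) (ι (y ∸ j)) (ι (suc m)) (ι (suc i)) α ⟩
      K + B ∎

  -- rowHooks x (λ j → m + colLen ν j) is the first-row hook product of ν with m + 1 rows of
  -- length x stacked on top.
  pieriSum-pole : ∀ ν → IsPartition ν → ∀ x m → All (_≤ x) ν →
    pieriSum ν (pole x m) * rowHooks (suc x) (λ j → m ℕ.+ colLen ν j)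
      ≈ φ α ν * rowHooks x (λ j → m ℕ.+ colLen ν j)
  pieriSum-pole [] _ x m _ = begin
    pieriSum [] (pole x m) * (K * R)  ≈⟨ *-congʳ (pieriSum-[] (pole x m)) ⟩
    K ⁻¹ * (K * R)
      ≈⟨ solve 3 (λ k′ k r → k′ :* (k :* r) := k :* k′ :* r) refl (K ⁻¹) K R ⟩
    K * K ⁻¹ * R                      ≈⟨ *-congʳ (inverse K (hook≉0 x (m ℕ.+ 0))) ⟩
    1# * R                            ∎
    where
    K R : Carrier
    K = hook x (m ℕ.+ 0)
    R = rowHooks x (λ _ → m ℕ.+ 0)
  pieriSum-pole (y ∷ μ) p x m (y≤x ∷ bounded) = *-cancelʳ Z≉0 (begin
    w * R₀′ * (Q * (K * E₁))
      ≈⟨ solve 5 (λ w r q k e → w :* r :* (q :* (k :* e)) := q :* w :* k :* (r :* e)) refl w R₀′ Q K E₁ ⟩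
    Q * w * K * (R₀′ * E₁)                ≈⟨ *-congʳ (*-congʳ first-row) ⟩
    K₁ * K ⁻¹ * v * K * (R₀′ * E₁)
      ≈⟨ solve 6 (λ k₁ k′ v k r e → k₁ :* k′ :* v :* k :* (r :* e) := k :* k′ :* (v :* (r :* (k₁ :* e))))
               refl K₁ (K ⁻¹) v K R₀′ E₁ ⟩
    K * K ⁻¹ * (v * (R₀′ * (K₁ * E₁)))
      ≈⟨ *-cong (inverse K (hook≉0 (x ∸ y) m)) (*-congˡ shift-suc-x) ⟩
    1# * (v * (R₁′ * (K * E₀)))          ≈⟨ trans (*-identityˡ _) (sym (*-assoc v R₁′ _)) ⟩
    v * R₁′ * (K * E₀)                   ≈⟨ *-congʳ (pieriSum-pole μ pμ x (suc m) bounded) ⟩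
    φ α μ * R₁ * (K * E₀)                ≈⟨ *-congʳ (*-congʳ (φ-cons y μ bμ)) ⟨
    φ α (y ∷ μ) * Q * R₁ * (K * E₀)
      ≈⟨ solve 5 (λ f q r k e → f :* q :* r :* (k :* e) := f :* q :* k :* (r :* e))
               refl (φ α (y ∷ μ)) Q R₁ K E₀ ⟩
    φ α (y ∷ μ) * Q * K * (R₁ * E₀)      ≈⟨ *-congˡ shift-x ⟨
    φ α (y ∷ μ) * Q * K * (R₀ * E₁)
      ≈⟨ solve 5 (λ f q k r e → f :* q :* k :* (r :* e) := f :* r :* (q :* (k :* e)))
               refl (φ α (y ∷ μ)) Q K R₀ E₁ ⟩
    φ α (y ∷ μ) * R₀ * (Q * (K * E₁))    ∎)
    where
    pμ : IsPartition μ
    pμ = IsPartition-tail p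
    bμ : All (_≤ y) μ
    bμ = IsPartition-bounded p
    Q K K₁ w v : Carrier
    Q  = rowHooks y (colLen μ)
    K  = hook (x ∸ y) m
    K₁ = hook (x ∸ y) (suc m)
    w  = pieriSum (y ∷ μ) (pole x m)
    v  = pieriSum μ (pole x (suc m))
    κ₀ κ₁ : ℕ → ℕ
    κ₀ j = m ℕ.+ colLen (y ∷ μ) j
    κ₁ j = suc m ℕ.+ colLen μ j
    R₀ R₀′ R₁ R₁′ E₀ E₁ : Carrier
    R₀  = rowHooks x κ₀
    R₀′ = rowHooks (suc x) κ₀
    R₁  = rowHooks x κ₁
    R₁′ = rowHooks (suc x) κ₁
    E₀  = rowHooks (x ∸ y) (const m)
    E₁  = rowHooks (x ∸ y) (const (suc m))
    Z≉0 : ¬ Q * (K * E₁) ≈ 0#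
    Z≉0 = *-≉0 (rowHooks≉0 y (colLen μ)) (*-≉0 (hook≉0 (x ∸ y) m) (rowHooks≉0 (x ∸ y) (const (suc m))))
    first-row : Q * w ≈ K₁ * K ⁻¹ * v
    first-row = trans
      (pieriSum-step y μ (pole x m) (λ b → K₁ * K ⁻¹ * pole x (suc m) b) p (pieriSum-pole μ pμ y 0 bμ)
                     (λ i → pole-peel {x} {y} {m} i (rowLen μ i) (rowLen-bounded bμ i) y≤x))
      (pieriSum-scale μ (K₁ * K ⁻¹) (pole x (suc m)))
    shift-x : R₀ * E₁ ≈ R₁ * E₀
    shift-x = rowHooks-cons {x} {y} {m} μ y≤x bμ
    shift-suc-x : R₀′ * (K₁ * E₁) ≈ R₁′ * (K * E₀)
    shift-suc-x = begin
      R₀′ * (K₁ * E₁)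
        ≡⟨ cong (λ k → R₀′ * rowHooks k (const (suc m))) (ℕₚ.+-∸-assoc 1 y≤x) ⟨
      R₀′ * rowHooks (suc x ∸ y) (const (suc m))
        ≈⟨ rowHooks-cons {suc x} {y} {m} μ (ℕₚ.m≤n⇒m≤1+n y≤x) bμ ⟩
      R₁′ * rowHooks (suc x ∸ y) (const m)
        ≡⟨ cong (λ k → R₁′ * rowHooks k (const m)) (ℕₚ.+-∸-assoc 1 y≤x) ⟩
      R₁′ * (K * E₀) ∎

  quadratic-peel : ∀ {y} A B C i j → j ≤ y →
    peel y (quadratic A B C ∘ content α) (box i j)
      ≈ quadratic A (B - A) (C + A * (ι y * α)) (content α (box i j))
          + - quadratic A B C (content α (box 0 y)) * pole y 0 (box i j)
  quadratic-peel {y} A B C i j j≤y = begin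
    quadratic A B C (content α (box (suc i) j)) * ((ι (y ∸ j) * α + ι i) * D ⁻¹)
      ≈⟨ *-cong (quadratic-cong A B C lower-content) (*-congʳ (trans (+-congʳ (*-congʳ (ι-∸ j≤y))) N≈)) ⟩
    quadratic A B C (z - 1#) * ((Y - z) * D ⁻¹)     ≈⟨ *-assoc _ _ _ ⟨
    quadratic A B C (z - 1#) * (Y - z) * D ⁻¹
      ≈⟨ divide-with-remainder (hook≉0 (y ∸ j) i)
           (trans (quadratic-division A B C z Y) (+-congʳ (*-congˡ (sym D≈)))) ⟩
    g z + - quadratic A B C Y * D ⁻¹
      ≈⟨ +-congˡ (*-congʳ (-‿cong (quadratic-cong A B C (solve 1 (λ Y → Y := Y :+ :- :0) refl Y)))) ⟩
    g z + - quadratic A B C (content α (box 0 y)) * D ⁻¹ ∎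
    where
    z Y D : Carrier
    z = content α (box i j)
    Y = ι y * α
    D = hook (y ∸ j) i
    g : Carrier → Carrier
    g = quadratic A (B - A) (C + A * Y)
    lower-content : content α (box (suc i) j) ≈ z - 1#
    lower-content = solve 3 (λ J I a → J :* a :+ :- (:1 :+ I) := J :* a :+ :- I :- :1) refl (ι j) (ι i) α
    N≈ : (ι y - ι j) * α + ι i ≈ Y - z
    N≈ = solve 4 (λ Y J I a → (Y :- J) :* a :+ I := Y :* a :- (J :* a :+ :- I)) refl (ι y) (ι j) (ι i) α
    D≈ : D ≈ Y + 1# - z
    D≈ = trans (+-congʳ (*-congʳ (ι-∸ j≤y)))
      (solve 4 (λ Y J I a → (Y :- J) :* a :+ (:1 :+ I) := Y :* a :+ :1 :- (J :* a :+ :- I))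
               refl (ι y) (ι j) (ι i) α)

  pieriSum-quadratic : ∀ ν → IsPartition ν → ∀ A B C →
    pieriSum ν (quadratic A B C ∘ content α) ≈ (A * (ι (size ν) * α) + C) * φ α ν
  pieriSum-quadratic [] _ A B C = trans (pieriSum-[] (quadratic A B C ∘ content α))
    (solve 4 (λ A B C a → A :* ((:0 :* a :+ :- :0) :* (:0 :* a :+ :- :0)) :+ B :* (:0 :* a :+ :- :0) :+ C
                          := (A :* (:0 :* a) :+ C) :* :1) refl A B C α)
  pieriSum-quadratic (y ∷ μ) p A B C = *-cancelʳ (rowHooks≉0 y (colLen μ)) (begin
    pieriSum (y ∷ μ) f * Q                                     ≈⟨ *-comm _ Q ⟩
    Q * pieriSum (y ∷ μ) f
      ≈⟨ pieriSum-step y μ f g p (pieriSum-pole μ pμ y 0 bμ)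
                       (λ i → quadratic-peel A B C i (rowLen μ i) (rowLen-bounded bμ i)) ⟩
    pieriSum μ g                                  ≈⟨ pieriSum-quadratic μ pμ A (B - A) (C + A * Y) ⟩
    (A * (ι n * α) + (C + A * Y)) * φ α μ                      ≈⟨ *-congˡ (φ-cons y μ bμ) ⟨
    (A * (ι n * α) + (C + A * Y)) * (φ α (y ∷ μ) * Q)
      ≈⟨ solve 7 (λ A C Y N a f q → (A :* (N :* a) :+ (C :+ A :* (Y :* a))) :* (f :* q)
                                     := (A :* ((Y :+ N) :* a) :+ C) :* f :* q)
               refl A C (ι y) (ι n) α (φ α (y ∷ μ)) Q ⟩
    (A * ((ι y + ι n) * α) + C) * φ α (y ∷ μ) * Q
      ≈⟨ *-congʳ (*-congʳ (+-congʳ (*-congˡ (*-congʳ (ι-+ y n))))) ⟨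
    (A * (ι (y ℕ.+ n) * α) + C) * φ α (y ∷ μ) * Q              ∎)
    where
    pμ : IsPartition μ
    pμ = IsPartition-tail p
    bμ : All (_≤ y) μ
    bμ = IsPartition-bounded p
    n : ℕ
    n  = size μ
    Q Y : Carrier
    Q  = rowHooks y (colLen μ)
    Y  = ι y * α
    f g : Box → Carrier
    f  = quadratic A B C ∘ content α
    g  = quadratic A (B - A) (C + A * Y) ∘ content α

mainTheorem9 : ∀ {c ℓ : Level} (F : Field c ℓ) →
    let open Field F
        open WithField F
    in (α : Carrier) →
       (∀ (a m : ℕ) → ¬ (ι a * α + ι (suc m) ≈ 0#)) →
       (u v : Carrier) (λ₀ : List ℕ) → IsPartition λ₀ →
       lhs α u v λ₀ ≈ (ι (size λ₀) * α + u * v) * φ α λ₀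
mainTheorem9 F α hook≉0 u v λ₀ p = begin
  lhs α u v λ₀                          ≈⟨ pieriSum-cong λ₀ f (q ∘ content α) (λ i → f≈q (newBox λ₀ i)) ⟩
  pieriSum λ₀ (q ∘ content α)           ≈⟨ pieriSum-quadratic λ₀ p 1# (u + v) (u * v) ⟩
  (1# * (ι n * α) + u * v) * φ α λ₀     ≈⟨ *-congʳ (+-congʳ (*-identityˡ _)) ⟩
  (ι n * α + u * v) * φ α λ₀            ∎
  where
  open Field F
  open WithField F
  open TransitionSums F α hook≉0
  open Quadratic commutativeRing
  open IntegerCoefficientSolver commutativeRing using (solve; _:*_; _:+_; :1; _:=_)
  open import Relation.Binary.Reasoning.Setoid setoid
  n : ℕ
  n = size λ₀
  f : Box → Carrier
  f b = (content α b + u) * (content α b + v)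
  q : Carrier → Carrier
  q = quadratic 1# (u + v) (u * v)
  f≈q : ∀ b → f b ≈ q (content α b)
  f≈q b = solve 3 (λ z u v → (z :+ u) :* (z :+ v) := :1 :* (z :* z) :+ (u :+ v) :* z :+ u :* v)
                  refl (content α b) u v
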